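{- Let $\mathfrak E$ be an EOS satisfying the standing assumptions below and let $\iota,\tau$ be configurations of $\mathfrak E$. If $\tau$ is $(\le_f,\omega)$-coverable from $\iota$ in $\mathfrak E$, then $\tau$ is $\le_f$-coverable from $\iota$ in $\mathfrak E^{cons}$.
   Context: EOS: A PN is $(P,T,F)$ with $F:(P\times T)\cup(T\times P)\to\mathbb N$, ${\tt pre}_N(t)(p)=F(p,t)$, ${\tt post}_N(t)(p)=F(t,p)$; $\blacksquare=(\emptyset,\emptyset,\emptyset)$ with unique marking $\varepsilon$. An EOS is $(\hat N,\mathcal N,d,\Theta)$: system PN $\hat N=(\hat P,\hat T,\hat F)$ containing idle transitions $id_p$ ($p\in\hat P$) consuming and producing one token on $p$ only; finite set $\mathcal N\ni\blacksquare$ of object PNs, all nets pairwise disjoint; typing $d:\hat P\to\mathcal N$; finite event set $\Theta$ of pairs $(\hat\tau,\theta)$, $\hat\tau\in\hat T$, $\theta(N)$ a finite multiset of transitions of $N$, with $\theta(d(p))\ne\emptyset$ if $\hat\tau=id_p$. Configurations: finite multisets of nested tokens $(\hat p,m)$, $m$ a marking of $d(\hat p)$. With $\Pi^1(\sum_i(\hat p_i,m_i))=\sum_i\hat p_i$, $\Pi^2_N(\sum_i(\hat p_i,m_i))=\sum_{d(\hat p_i)=N}m_i$: event $(\hat\tau,\theta)$ fires on $\mu$ with mode $(\lambda,\rho)$ iff $\lambda\sqsubseteq\mu$, $\Pi^1(\lambda)={\tt pre}_{\hat N}(\hat\tau)$, $\Pi^1(\rho)={\tt post}_{\hat N}(\hat\tau)$,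 and for all $N$: $\Pi^2_N(\lambda)\ge{\tt pre}_N(\theta(N))$, $\Pi^2_N(\rho)=\Pi^2_N(\lambda)-{\tt pre}_N(\theta(N))+{\tt post}_N(\theta(N))$; result $\mu-\lambda+\rho$. $\mu\le_f\mu'$ iff $\mu'$ arises from $\mu$ by adding tokens inside existing nested tokens and/or adding nested tokens. An event is system autonomous if $\theta(N)=\emptyset$ for all $N$. $\tau$ is $\le_f$-coverable from $\iota$ if some configuration reachable from $\iota$ by event firings is $\ge_f\tau$. A $(\le_f,\omega)$-run is a finite sequence of configurations in which each consecutive pair is a firing step $C_i\to^eC_{i+1}$ or a lossy step $C_{i+1}\le_f C_i$; $\tau$ is $(\le_f,\omega)$-coverable from $\iota$ if such a run leads from $\iota$ to some configuration $\ge_f\tau$. $t\in\hat T$ destroys type $N$ if $\hat F(p,t)\ne0$ for some $p$ with $d(p)=N$ and $\hat F(t,q)=0$ for all $q$ with $d(q)=N$; $\mathit{destroy}(t)$ is the set of such $N$. Standing assumptions on $\mathfrak E$: every $t\in\hat T$ occurs in exactly one event of $\Theta$, and if $\mathit{destroy}(t)\ne\emptyset$ that event is system autonomous. Conservative closure: $\mathfrak E^{cons}=(\hat N^{cons},\mathcal N,d^{cons},\Theta)$, $\hat N^{cons}=(\hat P\cup\{\mathit{trash}_N:N\in\mathcal N\},\hat T,\hat F^{cons})$ with new places $\mathit{trash}_N$, $\hat F^{cons}(p,t)=\hat F(p,t)$ (zero on trash places), $\hat F^{cons}(t,p)=\hat F(t,p)$ for $p\in\hat P$, $\hat F^{cons}(t,\mathit{trash}_N)=1$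 iff $N\in\mathit{destroy}(t)$ (else $0$), $d^{cons}$ extends $d$ by $d^{cons}(\mathit{trash}_N)=N$. Configurations of $\mathfrak E$ are configurations of $\mathfrak E^{cons}$. -}

module Defs where

open import Data.Nat using (ℕ; zero; suc; _+_; _∸_; _≤_)
open import Data.Fin using (Fin)
open import Data.Fin.Properties as FinP using (any?; all?)
open import Data.Bool using (if_then_else_)
open import Data.List using (List; []; _∷_; _++_; map)
open import Data.List.Membership.Propositional using (_∈_)
open import Data.List.Relation.Binary.Permutation.Propositional using (_↭_)
open import Data.List.Relation.Binary.Pointwise using (Pointwise)
open import Data.Product using (Σ; ∃; ∃-syntax; _×_; _,_; proj₁; proj₂)
open import Data.Sum using (_⊎_; inj₁; inj₂)
import Data.Sum.Properties as SumP
open import Relation.Nullary using (¬_; Dec; yes; no)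
open import Relation.Nullary.Decidable using (⌊_⌋; _×-dec_; _→-dec_; ¬?)
open import Relation.Binary using (DecidableEquality)
open import Relation.Binary.PropositionalEquality using (_≡_; _≢_; refl)
open import Relation.Binary.Construct.Closure.ReflexiveTransitive using (Star)

-- Object Petri nets (finite place / transition sets, given as Fin types).
-- pre t p = F(p,t),  post t p = F(t,p).  Distinct nets are distinct
-- records, hence pairwise disjoint automatically.

record ObjNet : Set where
  field
    np   : ℕ
    nt   : ℕ
    pre  : Fin nt → Fin np → ℕ
    post : Fin nt → Fin np → ℕ

open ObjNet

Marking : ObjNet → Set
Marking N = Fin (np N) → ℕ

preM : (N : ObjNet) → List (Fin (nt N)) → Marking N
preM N []       x = 0
preM N (t ∷ ts) x = pre N t x + preM N ts x

postM : (N : ObjNet) → List (Fin (nt N)) → Marking N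
postM N []       x = 0
postM N (t ∷ ts) x = post N t x + postM N ts x

-- Events (τ̂, θ): θ(N) is a finite multiset (list) of transitions of N.
Event : (nT k : ℕ) → (Fin k → ObjNet) → Set
Event nT k obj = Fin nT × ((i : Fin k) → List (Fin (nt (obj i))))

EventEq : ∀ {nT k obj} → Event nT k obj → Event nT k obj → Set
EventEq {k = k} (t , θ) (t' , θ') = t ≡ t' × ((i : Fin k) → θ i ≡ θ' i)

SystemAutonomous : ∀ {nT k obj} → Event nT k obj → Set
SystemAutonomous {k = k} (t , θ) = (i : Fin k) → θ i ≡ []

-- The system places form
-- a type with decidable equality (Fin n for an EOS, Fin n ⊎ Fin k for the
-- conservative closure).  Fi p t = F̂(p,t), Fo t p = F̂(t,p).

record RawEOS : Set₁ where
  field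
    SP   : Set
    _≟SP_ : DecidableEquality SP
    nT   : ℕ
    Fi   : SP → Fin nT → ℕ
    Fo   : Fin nT → SP → ℕ
    k    : ℕ
    obj  : Fin k → ObjNet
    d    : SP → Fin k
    Θ    : List (Event nT k obj)

module _ (R : RawEOS) where
  open RawEOS R

  NestedToken : Set
  NestedToken = Σ SP λ p → Marking (obj (d p))

  Config : Set
  Config = List NestedToken

  Π¹ : Config → SP → ℕ
  Π¹ []             q = 0
  Π¹ ((p , m) ∷ μ)  q = (if ⌊ p ≟SP q ⌋ then 1 else 0) + Π¹ μ q

  addIf : (N : Fin k) (p : SP) → Marking (obj (d p)) → Dec (d p ≡ N) →
          Marking (obj N) → Marking (obj N)
  addIf N p m (yes refl) acc x = m x + acc x
  addIf N p m (no _)     acc x = acc x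

  Π² : (N : Fin k) → Config → Marking (obj N)
  Π² N []            x = 0
  Π² N ((p , m) ∷ μ) x = addIf N p m (d p FinP.≟ N) (Π² N μ) x

  -- event e fires on μ with mode (λ,ρ), λ ⊑ μ witnessed by μ ↭ λ ++ rest,
  -- and the result μ - λ + ρ is rest ++ ρ.
  FiresWithMode : Event nT k obj → Config → Config → Config → Config → Set
  FiresWithMode (t , θ) μ lam ρ μ' =
    Σ Config λ rest →
      (μ ↭ lam ++ rest)
    × ((p : SP) → Π¹ lam p ≡ Fi p t)
    × ((p : SP) → Π¹ ρ p ≡ Fo t p)
    × ((N : Fin k) (x : Fin (np (obj N))) → preM (obj N) (θ N) x ≤ Π² N lam x)
    × ((N : Fin k) (x : Fin (np (obj N))) →
         Π² N ρ x ≡ Π² N lam x ∸ preM (obj N) (θ N) x + postM (obj N) (θ N) x)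
    × (μ' ≡ rest ++ ρ)

  Step : Config → Config → Set
  Step μ μ' = Σ (Event nT k obj) λ e → e ∈ Θ ×
              ∃[ lam ] ∃[ ρ ] FiresWithMode e μ lam ρ μ'

  data _≤ₜ_ : NestedToken → NestedToken → Set where
    ≤ₜ-mk : ∀ {p m m'} → ((x : Fin (np (obj (d p)))) → m x ≤ m' x) →
            (p , m) ≤ₜ (p , m')

  -- μ ≤f μ' : μ' arises from μ by adding tokens inside existing nested
  -- tokens and/or adding nested tokens
  _≤f_ : Config → Config → Set
  μ ≤f μ' = ∃[ ν ] ∃[ extra ] (Pointwise _≤ₜ_ μ ν × (μ' ↭ ν ++ extra))

  Coverable : Config → Config → Set
  Coverable ι τ = ∃[ C ] (Star Step ι C × τ ≤f C)

  LossyOrStep : Config → Config → Set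
  LossyOrStep C C' = Step C C' ⊎ C' ≤f C

  ωCoverable : Config → Config → Set
  ωCoverable ι τ = ∃[ C ] (Star LossyOrStep ι C × τ ≤f C)

indic : ∀ {n} → Fin n → Fin n → ℕ
indic p q = if ⌊ p FinP.≟ q ⌋ then 1 else 0

record EOS : Set where
  field
    n    : ℕ
    nT   : ℕ
    Fi   : Fin n → Fin nT → ℕ
    Fo   : Fin nT → Fin n → ℕ
    k    : ℕ
    obj  : Fin k → ObjNet
    d    : Fin n → Fin k
    Θ    : List (Event nT k obj)
    idle    : Fin n → Fin nT
    idle-pre  : ∀ p q → Fi q (idle p) ≡ indic p q
    idle-post : ∀ p q → Fo (idle p) q ≡ indic p q
    blank    : Fin k
    blank-np : np (obj blank) ≡ 0
    blank-nt : nt (obj blank) ≡ 0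
    idle-event : ∀ e → e ∈ Θ → ∀ p → proj₁ e ≡ idle p → proj₂ e (d p) ≢ []

  raw : RawEOS
  raw = record { SP = Fin n ; _≟SP_ = FinP._≟_ ; nT = nT ; Fi = Fi ; Fo = Fo
               ; k = k ; obj = obj ; d = d ; Θ = Θ }

  Destroys : Fin nT → Fin k → Set
  Destroys t N = (∃[ p ] (d p ≡ N × Fi p t ≢ 0)) × (∀ q → d q ≡ N → Fo t q ≡ 0)

  destroys? : ∀ t N → Dec (Destroys t N)
  destroys? t N =
    any? {P = λ p → d p ≡ N × Fi p t ≢ 0}
         (λ p → (d p FinP.≟ N) ×-dec ¬? (Fi p t Data.Nat.≟ 0))
    ×-dec all? {P = λ q → d q ≡ N → Fo t q ≡ 0}
         (λ q → (d q FinP.≟ N) →-dec (Fo t q Data.Nat.≟ 0))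

  StandingAssumptions : Set
  StandingAssumptions =
      (∀ t → ∃[ e ] (e ∈ Θ × proj₁ e ≡ t))
    × (∀ t e e' → e ∈ Θ → e' ∈ Θ → proj₁ e ≡ t → proj₁ e' ≡ t → EventEq {nT} {k} {obj} e e')
    × (∀ e → e ∈ Θ → (∃[ N ] Destroys (proj₁ e) N) → SystemAutonomous {nT} {k} {obj} e)

  -- conservative closure: places Fin n ⊎ Fin k (inj₂ N = trash_N)
  FiCons : Fin n ⊎ Fin k → Fin nT → ℕ
  FiCons (inj₁ p) t = Fi p t
  FiCons (inj₂ N) t = 0

  FoCons : Fin nT → Fin n ⊎ Fin k → ℕ
  FoCons t (inj₁ p) = Fo t p
  FoCons t (inj₂ N) = if ⌊ destroys? t N ⌋ then 1 else 0

  dCons : Fin n ⊎ Fin k → Fin k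
  dCons (inj₁ p) = d p
  dCons (inj₂ N) = N

  cons : RawEOS
  cons = record
    { SP = Fin n ⊎ Fin k
    ; _≟SP_ = SumP.≡-dec FinP._≟_ FinP._≟_
    ; nT = nT
    ; Fi = FiCons
    ; Fo = FoCons
    ; k = k ; obj = obj
    ; d = dCons
    ; Θ = Θ }

  liftConfig : Config raw → Config cons
  liftConfig = map (λ { (p , m) → (inj₁ p , m) })

{-# OPTIONS --safe #-}
-- Simulate the (≤_f, ω)-run by a run of 𝔈^cons, keeping each configuration C
-- of the run ≤_f the current configuration D of the simulation; lossy steps
-- keep this by transitivity.  A firing of 𝔈 is a firing of 𝔈^cons that also
-- puts empty tokens on the trash places of the destroyed types.  𝔈^cons is
-- conservative (a transition consuming a token of type N also produces one,
-- on trash_N if nowhere else), and in a conservative EOS firing is monotone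
-- for ≤_f: the surplus that D carries in the consumed tokens is added to a
-- produced token of the same type, which preserves the balance
-- Π²_N(ρ) = Π²_N(λ) - pre + post.
module Submission where

open import Defs
open import Function using (_∘_)
open import Data.Nat as ℕ using (ℕ; zero; suc; _+_; _∸_; _≤_)
open import Data.Nat.Properties
  using ( ≤-refl; ≤-trans; +-mono-≤; m≤n+m; +-assoc; +-identityʳ; +-∸-assoc; m∸n+n≡m
        ; 0∸n≡0; m+n≡0⇒n≡0; 1+n≢0)
open import Data.Fin as Fin using (Fin)
open import Data.Fin.Properties using (_≟_; any?; suc-injective)
open import Data.Bool using (Bool; true; false; if_then_else_)
open import Data.List using (List; []; _∷_; [_]; _++_; concat; tabulate)
open import Data.List.Properties using (++-identityʳ; map-++)
import Data.List.Properties as List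
open import Data.Nat.ListAction using (sum)
open import Data.List.Membership.Propositional using (_∈_)
open import Data.List.Relation.Binary.Permutation.Propositional
  using (_↭_; prep; swap; ↭-refl; ↭-trans; ↭-reflexive; module PermutationReasoning)
import Data.List.Relation.Binary.Permutation.Propositional as ↭
import Data.List.Relation.Binary.Permutation.Propositional.Properties as ↭
open import Data.List.Relation.Binary.Pointwise using (Pointwise; []; _∷_)
import Data.List.Relation.Binary.Pointwise as Pointwise
open import Data.List.Relation.Unary.Any using (Any; here; there)
import Data.List.Relation.Unary.Any as Any
open import Data.Product using (∃-syntax; ∃₂; _×_; _,_; proj₁)
open import Data.Sum using (_⊎_; inj₁; inj₂)
open import Data.Empty using (⊥-elim)
open import Relation.Nullary using (¬_; Dec; yes; no)
open import Relation.Nullary.Decidable using (⌊_⌋; _×-dec_; ¬?; decidable-stable; ⌊⌋-map′)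
open import Relation.Binary using (Reflexive; Transitive)
open import Relation.Binary.PropositionalEquality hiding ([_])
open import Relation.Binary.Construct.Closure.ReflexiveTransitive using (Star; ε; _◅_; _◅◅_)

m∸n+[n∸o+p]≡m∸o+p : ∀ {m n o} p → o ≤ n → n ≤ m → (m ∸ n) + (n ∸ o + p) ≡ m ∸ o + p
m∸n+[n∸o+p]≡m∸o+p {m} {n} {o} p o≤n n≤m = begin
  (m ∸ n) + (n ∸ o + p)   ≡⟨ sym (+-assoc (m ∸ n) (n ∸ o) p) ⟩
  (m ∸ n) + (n ∸ o) + p   ≡⟨ cong (_+ p) (sym (+-∸-assoc (m ∸ n) o≤n)) ⟩
  (m ∸ n + n) ∸ o + p     ≡⟨ cong (λ z → z ∸ o + p) (m∸n+n≡m n≤m) ⟩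
  m ∸ o + p               ∎
  where open ≡-Reasoning

sum-tabulate-zero : ∀ {n} (f : Fin n → ℕ) → (∀ i → f i ≡ 0) → sum (tabulate f) ≡ 0
sum-tabulate-zero {zero}  f vanishes = refl
sum-tabulate-zero {suc n} f vanishes =
  cong₂ _+_ (vanishes Fin.zero) (sum-tabulate-zero (f ∘ Fin.suc) (vanishes ∘ Fin.suc))

sum-tabulate-single : ∀ {n} (f : Fin n → ℕ) i → (∀ j → j ≢ i → f j ≡ 0) → sum (tabulate f) ≡ f i
sum-tabulate-single f Fin.zero vanishes =
  trans (cong (f Fin.zero +_) (sum-tabulate-zero (f ∘ Fin.suc) (λ j → vanishes (Fin.suc j) λ ())))
        (+-identityʳ _)
sum-tabulate-single f (Fin.suc i) vanishes =
  cong₂ _+_ (vanishes Fin.zero λ ())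
            (sum-tabulate-single (f ∘ Fin.suc) i (λ j j≢i → vanishes (Fin.suc j) (j≢i ∘ suc-injective)))

concat-tabulate-hom : ∀ {A : Set} (φ : List A → ℕ) → φ [] ≡ 0 → (∀ xs ys → φ (xs ++ ys) ≡ φ xs + φ ys) →
                      ∀ {n} (f : Fin n → List A) → φ (concat (tabulate f)) ≡ sum (tabulate (φ ∘ f))
concat-tabulate-hom φ φ[] φ-++ {zero}  f = φ[]
concat-tabulate-hom φ φ[] φ-++ {suc n} f =
  trans (φ-++ (f Fin.zero) _) (cong (φ (f Fin.zero) +_) (concat-tabulate-hom φ φ[] φ-++ (f ∘ Fin.suc)))

module RawEOSProperties (R : RawEOS) where
  open RawEOS R

  infix 4 _≼ₜ_ _≼_

  _≼ₜ_ : Config R → Config R → Set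
  _≼ₜ_ = Pointwise (_≤ₜ_ R)

  _≼_ : Config R → Config R → Set
  _≼_ = _≤f_ R

  ≤ₜ-refl : Reflexive (_≤ₜ_ R)
  ≤ₜ-refl = ≤ₜ-mk (λ _ → ≤-refl)

  ≤ₜ-trans : Transitive (_≤ₜ_ R)
  ≤ₜ-trans (≤ₜ-mk f) (≤ₜ-mk g) = ≤ₜ-mk (λ x → ≤-trans (f x) (g x))

  ≼ₜ-refl : Reflexive _≼ₜ_
  ≼ₜ-refl = Pointwise.refl ≤ₜ-refl

  ≼ₜ-trans : Transitive _≼ₜ_
  ≼ₜ-trans = Pointwise.transitive ≤ₜ-trans

  ≼ₜ-++⁻ : ∀ xs {ys zs} → xs ++ ys ≼ₜ zs → ∃₂ λ us vs → zs ≡ us ++ vs × xs ≼ₜ us × ys ≼ₜ vs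
  ≼ₜ-++⁻ []       ys≼ₜ = [] , _ , refl , [] , ys≼ₜ
  ≼ₜ-++⁻ (_ ∷ xs) (x≤ₜ ∷ xs++ys≼ₜ) with ≼ₜ-++⁻ xs xs++ys≼ₜ
  ... | us , vs , refl , xs≼ₜ , ys≼ₜ = _ ∷ us , vs , refl , x≤ₜ ∷ xs≼ₜ , ys≼ₜ

  ≼ₜ-↭ : ∀ {xs ys xs′} → xs ≼ₜ ys → xs ↭ xs′ → ∃[ ys′ ] (ys ↭ ys′ × xs′ ≼ₜ ys′)
  ≼ₜ-↭ xs≼ₜ ↭.refl = _ , ↭-refl , xs≼ₜ
  ≼ₜ-↭ (x≤ₜ ∷ xs≼ₜ) (prep _ xs↭) with ≼ₜ-↭ xs≼ₜ xs↭
  ... | ys′ , ys↭ , xs′≼ₜ = _ ∷ ys′ , prep _ ys↭ , x≤ₜ ∷ xs′≼ₜ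
  ≼ₜ-↭ (x≤ₜ ∷ y≤ₜ ∷ xs≼ₜ) (swap _ _ xs↭) with ≼ₜ-↭ xs≼ₜ xs↭
  ... | ys′ , ys↭ , xs′≼ₜ = _ ∷ _ ∷ ys′ , swap _ _ ys↭ , y≤ₜ ∷ x≤ₜ ∷ xs′≼ₜ
  ≼ₜ-↭ xs≼ₜ (↭.trans xs↭ xs′↭) with ≼ₜ-↭ xs≼ₜ xs↭
  ... | ys′ , ys↭ , xs′≼ₜ with ≼ₜ-↭ xs′≼ₜ xs′↭
  ...   | ys″ , ys′↭ , xs″≼ₜ = ys″ , ↭-trans ys↭ ys′↭ , xs″≼ₜ

  ≼ₜ⇒≼ : ∀ {xs ys} → xs ≼ₜ ys → xs ≼ ys
  ≼ₜ⇒≼ {ys = ys} xs≼ₜ = ys , [] , xs≼ₜ , ↭-reflexive (sym (++-identityʳ ys))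

  ≼-refl : Reflexive _≼_
  ≼-refl = ≼ₜ⇒≼ ≼ₜ-refl

  ≼-extend : ∀ xs ys → xs ≼ xs ++ ys
  ≼-extend xs ys = xs , ys , ≼ₜ-refl , ↭-refl

  ≼-respˡ-↭ : ∀ {xs xs′ zs} → xs ↭ xs′ → xs ≼ zs → xs′ ≼ zs
  ≼-respˡ-↭ xs↭ (ν , extra , xs≼ₜ , zs↭) with ≼ₜ-↭ xs≼ₜ xs↭
  ... | ν′ , ν↭ , xs′≼ₜ = ν′ , extra , xs′≼ₜ , ↭-trans zs↭ (↭.++⁺ʳ extra ν↭)

  ≼-++⁻ : ∀ {xs ys zs} → xs ++ ys ≼ zs → ∃₂ λ us vs → zs ↭ us ++ vs × xs ≼ₜ us × ys ≼ vs
  ≼-++⁻ {xs} (ν , extra , xs++ys≼ₜ , zs↭) with ≼ₜ-++⁻ xs xs++ys≼ₜ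
  ... | us , vs , refl , xs≼ₜ , ys≼ₜ =
    us , vs ++ extra , ↭-trans zs↭ (↭.++-assoc us vs extra) , xs≼ₜ , (vs , extra , ys≼ₜ , ↭-refl)

  ≼-trans : Transitive _≼_
  ≼-trans (ν , _ , xs≼ₜ , ys↭) ys≼zs with ≼-++⁻ (≼-respˡ-↭ ys↭ ys≼zs)
  ... | us , vs , zs↭ , ν≼ₜ , _ = us , vs , ≼ₜ-trans xs≼ₜ ν≼ₜ , zs↭

  ≼-++⁺ : ∀ {xs xs′ ys ys′} → xs ≼ xs′ → ys ≼ ys′ → xs ++ ys ≼ xs′ ++ ys′
  ≼-++⁺ {xs′ = xs′} {ys′ = ys′} (ν , extra , xs≼ₜ , xs′↭) (ν′ , extra′ , ys≼ₜ , ys′↭) =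
    ν ++ ν′ , extra ++ extra′ , Pointwise.++⁺ xs≼ₜ ys≼ₜ , interchange
    where
      open PermutationReasoning
      interchange : xs′ ++ ys′ ↭ (ν ++ ν′) ++ (extra ++ extra′)
      interchange = begin
        xs′ ++ ys′                        ↭⟨ ↭.++⁺ xs′↭ ys′↭ ⟩
        (ν ++ extra) ++ (ν′ ++ extra′)    ≡⟨ List.++-assoc ν extra _ ⟩
        ν ++ (extra ++ ν′ ++ extra′)      ↭⟨ ↭.++⁺ˡ ν (↭.shifts extra ν′) ⟩
        ν ++ (ν′ ++ extra ++ extra′)      ≡⟨ sym (List.++-assoc ν ν′ _) ⟩
        (ν ++ ν′) ++ (extra ++ extra′)    ∎

  Π¹-++ : ∀ xs ys q → Π¹ R (xs ++ ys) q ≡ Π¹ R xs q + Π¹ R ys q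
  Π¹-++ []            ys q = refl
  Π¹-++ ((p , m) ∷ xs) ys q =
    trans (cong (_ +_) (Π¹-++ xs ys q)) (sym (+-assoc _ (Π¹ R xs q) (Π¹ R ys q)))

  Π²-++ : ∀ N xs ys x → Π² R N (xs ++ ys) x ≡ Π² R N xs x + Π² R N ys x
  Π²-++ N []             ys x = refl
  Π²-++ N ((p , m) ∷ xs) ys x with d p ≟ N
  ... | yes refl = trans (cong (m x +_) (Π²-++ N xs ys x)) (sym (+-assoc (m x) _ _))
  ... | no _     = Π²-++ N xs ys x

  Π¹-≼ₜ : ∀ {xs ys} → xs ≼ₜ ys → ∀ q → Π¹ R xs q ≡ Π¹ R ys q
  Π¹-≼ₜ []               q = refl
  Π¹-≼ₜ (≤ₜ-mk _ ∷ xs≼ₜ) q = cong (_ +_) (Π¹-≼ₜ xs≼ₜ q)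

  Π²-≼ₜ : ∀ {xs ys} → xs ≼ₜ ys → ∀ N x → Π² R N xs x ≤ Π² R N ys x
  Π²-≼ₜ []                     N x = ≤-refl
  Π²-≼ₜ (≤ₜ-mk {p} m≤ ∷ xs≼ₜ) N x with d p ≟ N
  ... | yes refl = +-mono-≤ (m≤ x) (Π²-≼ₜ xs≼ₜ N x)
  ... | no _     = Π²-≼ₜ xs≼ₜ N x

  HasType : Fin k → Config R → Set
  HasType N = Any (λ token → d (proj₁ token) ≡ N)

  hasType? : ∀ N xs → Dec (HasType N xs)
  hasType? N = Any.any? (λ token → d (proj₁ token) ≟ N)

  Π¹≢0⇒HasType : ∀ xs q → Π¹ R xs q ≢ 0 → HasType (d q) xs
  Π¹≢0⇒HasType []             q Π¹≢0 = ⊥-elim (Π¹≢0 refl)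
  Π¹≢0⇒HasType ((p , m) ∷ xs) q Π¹≢0 with p ≟SP q
  ... | yes refl = here refl
  ... | no _     = there (Π¹≢0⇒HasType xs q Π¹≢0)

  HasType⇒Π¹≢0 : ∀ {N xs} → HasType N xs → ∃[ q ] (d q ≡ N × Π¹ R xs q ≢ 0)
  HasType⇒Π¹≢0 {xs = (p , m) ∷ xs} (here dp≡N) = p , dp≡N , occupied
    where
      occupied : Π¹ R ((p , m) ∷ xs) p ≢ 0
      occupied with p ≟SP p
      ... | yes _  = 1+n≢0
      ... | no p≢p = ⊥-elim (p≢p refl)
  HasType⇒Π¹≢0 (there hasType) with HasType⇒Π¹≢0 hasType
  ... | q , dq≡N , Π¹≢0 = q , dq≡N , Π¹≢0 ∘ m+n≡0⇒n≡0 _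

  ¬HasType⇒Π²≡0 : ∀ {N} xs → ¬ HasType N xs → ∀ x → Π² R N xs x ≡ 0
  ¬HasType⇒Π²≡0 []             _        x = refl
  ¬HasType⇒Π²≡0 {N} ((p , m) ∷ xs) ¬hasType x with d p ≟ N
  ... | yes dp≡N = ⊥-elim (¬hasType (here dp≡N))
  ... | no _     = ¬HasType⇒Π²≡0 xs (¬hasType ∘ there) x

  Markings : Set
  Markings = (N : Fin k) → Marking (obj N)

  clearAt : Fin k → Markings → Markings
  clearAt N e M with M ≟ N
  ... | yes _ = λ _ → 0
  ... | no _  = e M

  clearAt-self : ∀ N e x → clearAt N e N x ≡ 0
  clearAt-self N e x with N ≟ N
  ... | yes _   = refl
  ... | no N≢N = ⊥-elim (N≢N refl)

  clearAt-other : ∀ N e {M} x → M ≢ N → clearAt N e M x ≡ e M x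
  clearAt-other N e {M} x M≢N with M ≟ N
  ... | yes M≡N = ⊥-elim (M≢N M≡N)
  ... | no _    = refl

  -- The marking e N is added to the first token of type N, if there is one.
  absorb : Markings → Config R → Config R
  absorb e []             = []
  absorb e ((p , m) ∷ xs) = (p , λ x → e (d p) x + m x) ∷ absorb (clearAt (d p) e) xs

  absorb-≼ₜ : ∀ e xs → xs ≼ₜ absorb e xs
  absorb-≼ₜ e []             = []
  absorb-≼ₜ e ((p , m) ∷ xs) =
    ≤ₜ-mk (λ x → m≤n+m (m x) (e (d p) x)) ∷ absorb-≼ₜ (clearAt (d p) e) xs

  Π²-absorb : ∀ M e xs → HasType M xs ⊎ (∀ y → e M y ≡ 0) →
              ∀ x → Π² R M (absorb e xs) x ≡ e M x + Π² R M xs x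
  Π²-absorb M e [] (inj₂ e≡0) x = sym (trans (+-identityʳ _) (e≡0 x))
  Π²-absorb M e ((p , m) ∷ xs) absorbable x with d p ≟ M
  ... | yes refl = begin
    e M x + m x + Π² R M (absorb (clearAt M e) xs) x
      ≡⟨ cong (e M x + m x +_) (Π²-absorb M (clearAt M e) xs (inj₂ (clearAt-self M e)) x) ⟩
    e M x + m x + (clearAt M e M x + Π² R M xs x)
      ≡⟨ cong (λ z → e M x + m x + (z + Π² R M xs x)) (clearAt-self M e x) ⟩
    e M x + m x + Π² R M xs x
      ≡⟨ +-assoc (e M x) (m x) _ ⟩
    e M x + (m x + Π² R M xs x)   ∎
    where open ≡-Reasoning
  ... | no dp≢M = trans (Π²-absorb M (clearAt (d p) e) xs (still-absorbable absorbable) x)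
                        (cong (_+ Π² R M xs x) (clearAt-other (d p) e x (dp≢M ∘ sym)))
    where
      still-absorbable : HasType M ((p , m) ∷ xs) ⊎ (∀ y → e M y ≡ 0) →
                         HasType M xs ⊎ (∀ y → clearAt (d p) e M y ≡ 0)
      still-absorbable (inj₁ (here dp≡M))  = ⊥-elim (dp≢M dp≡M)
      still-absorbable (inj₁ (there hasM)) = inj₁ hasM
      still-absorbable (inj₂ e≡0)          =
        inj₂ (λ y → trans (clearAt-other (d p) e y (dp≢M ∘ sym)) (e≡0 y))

  record Mode (t : Fin nT) (θ : (N : Fin k) → List (Fin (ObjNet.nt (obj N)))) (lam ρ : Config R) : Set where
    constructor mode
    field
      consumes : ∀ p → Π¹ R lam p ≡ Fi p t
      produces : ∀ p → Π¹ R ρ p ≡ Fo t p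
      enabled  : ∀ N x → preM (obj N) (θ N) x ≤ Π² R N lam x
      effect   : ∀ N x → Π² R N ρ x ≡ Π² R N lam x ∸ preM (obj N) (θ N) x + postM (obj N) (θ N) x

  fire : ∀ {t θ μ lam ρ rest} → (t , θ) ∈ Θ → μ ↭ lam ++ rest → Mode t θ lam ρ → Step R μ (rest ++ ρ)
  fire {t} {θ} {lam = lam} {ρ} {rest} t,θ∈Θ μ↭ (mode consumes produces enabled effect) =
    (t , θ) , t,θ∈Θ , lam , ρ , rest , μ↭ , consumes , produces , enabled , effect , refl

  Conservative : Set
  Conservative = ∀ t N → ∃[ p ] (d p ≡ N × Fi p t ≢ 0) → ∃[ q ] (d q ≡ N × Fo t q ≢ 0)

  conservative⇒HasType-preserved :
    Conservative → ∀ {t lam ρ N} → (∀ p → Π¹ R lam p ≡ Fi p t) → (∀ p → Π¹ R ρ p ≡ Fo t p) →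
    HasType N lam → HasType N ρ
  conservative⇒HasType-preserved conservative {t} {ρ = ρ} {N} consumes produces hasType
    with HasType⇒Π¹≢0 hasType
  ... | p , dp≡N , Π¹≢0 with conservative t N (p , dp≡N , Π¹≢0 ∘ trans (consumes p))
  ...   | q , dq≡N , Fo≢0 = subst (λ M → HasType M ρ) dq≡N
                                  (Π¹≢0⇒HasType ρ q (Fo≢0 ∘ trans (sym (produces q))))

  surplus : Config R → Config R → Markings
  surplus lam lam′ N x = Π² R N lam′ x ∸ Π² R N lam x

  Mode-≼ₜ : Conservative → ∀ {t θ lam lam′ ρ} → Mode t θ lam ρ → lam ≼ₜ lam′ →
            Mode t θ lam′ (absorb (surplus lam lam′) ρ)
  Mode-≼ₜ conservative {t} {θ} {lam} {lam′} {ρ} (mode consumes produces enabled effect) lam≼ₜ =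
    mode consumes′ produces′ enabled′ effect′
    where
      s = surplus lam lam′

      consumes′ : ∀ p → Π¹ R lam′ p ≡ Fi p t
      consumes′ p = trans (sym (Π¹-≼ₜ lam≼ₜ p)) (consumes p)

      produces′ : ∀ p → Π¹ R (absorb s ρ) p ≡ Fo t p
      produces′ p = trans (sym (Π¹-≼ₜ (absorb-≼ₜ s ρ) p)) (produces p)

      enabled′ : ∀ N x → preM (obj N) (θ N) x ≤ Π² R N lam′ x
      enabled′ N x = ≤-trans (enabled N x) (Π²-≼ₜ lam≼ₜ N x)

      absorbable : ∀ N → HasType N ρ ⊎ (∀ y → s N y ≡ 0)
      absorbable N with hasType? N lam′
      ... | yes hasN = inj₁ (conservative⇒HasType-preserved conservative consumes′ produces hasN)
      ... | no ¬hasN = inj₂ (λ y → trans (cong (_∸ Π² R N lam y) (¬HasType⇒Π²≡0 lam′ ¬hasN y))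
                                         (0∸n≡0 (Π² R N lam y)))

      effect′ : ∀ N x → Π² R N (absorb s ρ) x ≡ Π² R N lam′ x ∸ preM (obj N) (θ N) x + postM (obj N) (θ N) x
      effect′ N x = begin
        Π² R N (absorb s ρ) x
          ≡⟨ Π²-absorb N s ρ (absorbable N) x ⟩
        s N x + Π² R N ρ x
          ≡⟨ cong (s N x +_) (effect N x) ⟩
        s N x + (Π² R N lam x ∸ preM (obj N) (θ N) x + postM (obj N) (θ N) x)
          ≡⟨ m∸n+[n∸o+p]≡m∸o+p _ (enabled N x) (Π²-≼ₜ lam≼ₜ N x) ⟩
        Π² R N lam′ x ∸ preM (obj N) (θ N) x + postM (obj N) (θ N) x   ∎
        where open ≡-Reasoning

  conservative⇒monotone : Conservative → ∀ {μ μ′ ν} → Step R μ μ′ → μ ≼ ν →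
                          ∃[ ν′ ] (Step R ν ν′ × μ′ ≼ ν′)
  conservative⇒monotone conservative
    ((t , θ) , t,θ∈Θ , lam , ρ , rest , μ↭ , consumes , produces , enabled , effect , refl) μ≼ν
    with ≼-++⁻ (≼-respˡ-↭ μ↭ μ≼ν)
  ... | lam′ , rest′ , ν↭ , lam≼ₜ , rest≼ =
    rest′ ++ absorb (surplus lam lam′) ρ ,
    fire t,θ∈Θ ν↭ (Mode-≼ₜ conservative (mode consumes produces enabled effect) lam≼ₜ) ,
    ≼-++⁺ rest≼ (≼ₜ⇒≼ (absorb-≼ₜ (surplus lam lam′) ρ))

module ConservativeClosure (E : EOS) where
  open EOS E
  module Raw  = RawEOSProperties raw
  module Cons = RawEOSProperties cons

  lift : Config raw → Config cons
  lift = liftConfig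

  lift-++ : ∀ xs ys → lift (xs ++ ys) ≡ lift xs ++ lift ys
  lift-++ = map-++ _

  lift-↭ : ∀ {xs ys} → xs ↭ ys → lift xs ↭ lift ys
  lift-↭ = ↭.map⁺ _

  lift-≼ₜ : ∀ {xs ys} → xs Raw.≼ₜ ys → lift xs Cons.≼ₜ lift ys
  lift-≼ₜ []                  = []
  lift-≼ₜ (≤ₜ-mk m≤ ∷ xs≼ₜ) = ≤ₜ-mk m≤ ∷ lift-≼ₜ xs≼ₜ

  lift-≼ : ∀ {xs ys} → xs Raw.≼ ys → lift xs Cons.≼ lift ys
  lift-≼ (ν , extra , xs≼ₜ , ys↭) =
    lift ν , lift extra , lift-≼ₜ xs≼ₜ , ↭-trans (lift-↭ ys↭) (↭-reflexive (lift-++ ν extra))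

  Π¹-lift-system : ∀ xs p → Π¹ cons (lift xs) (inj₁ p) ≡ Π¹ raw xs p
  Π¹-lift-system []             p = refl
  Π¹-lift-system ((q , m) ∷ xs) p =
    cong₂ (λ b n → (if b then 1 else 0) + n) (⌊⌋-map′ _ _ (q ≟ p)) (Π¹-lift-system xs p)

  Π¹-lift-trash : ∀ xs N → Π¹ cons (lift xs) (inj₂ N) ≡ 0
  Π¹-lift-trash []             N = refl
  Π¹-lift-trash ((q , m) ∷ xs) N = Π¹-lift-trash xs N

  Π²-lift : ∀ N xs x → Π² cons N (lift xs) x ≡ Π² raw N xs x
  Π²-lift N []             x = refl
  Π²-lift N ((q , m) ∷ xs) x with d q ≟ N
  ... | yes refl = cong (m x +_) (Π²-lift N xs x)
  ... | no _     = Π²-lift N xs x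

  trashToken : Fin k → NestedToken cons
  trashToken N = inj₂ N , λ _ → 0

  trashIf : Bool → Fin k → Config cons
  trashIf true  N = [ trashToken N ]
  trashIf false N = []

  trashFor : Fin nT → Fin k → Config cons
  trashFor t N = trashIf ⌊ destroys? t N ⌋ N

  trashes : Fin nT → Config cons
  trashes t = concat (tabulate (trashFor t))

  Π¹-trashIf-system : ∀ b N p → Π¹ cons (trashIf b N) (inj₁ p) ≡ 0
  Π¹-trashIf-system true  N p = refl
  Π¹-trashIf-system false N p = refl

  Π¹-trashIf-other : ∀ b {N M} → N ≢ M → Π¹ cons (trashIf b N) (inj₂ M) ≡ 0
  Π¹-trashIf-other true  {N} {M} N≢M with N ≟ M
  ... | yes N≡M = ⊥-elim (N≢M N≡M)
  ... | no _    = refl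
  Π¹-trashIf-other false N≢M = refl

  Π¹-trashIf-self : ∀ b M → Π¹ cons (trashIf b M) (inj₂ M) ≡ (if b then 1 else 0)
  Π¹-trashIf-self true  M with M ≟ M
  ... | yes _   = refl
  ... | no M≢M = ⊥-elim (M≢M refl)
  Π¹-trashIf-self false M = refl

  Π²-trashIf : ∀ b N M x → Π² cons M (trashIf b N) x ≡ 0
  Π²-trashIf true  N M x with N ≟ M
  ... | yes refl = refl
  ... | no _     = refl
  Π²-trashIf false N M x = refl

  Π¹-trashes : ∀ t q → Π¹ cons (trashes t) q ≡ sum (tabulate (λ N → Π¹ cons (trashFor t N) q))
  Π¹-trashes t q = concat-tabulate-hom (λ xs → Π¹ cons xs q) refl (λ xs ys → Cons.Π¹-++ xs ys q) (trashFor t)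

  Π¹-trashes-system : ∀ t p → Π¹ cons (trashes t) (inj₁ p) ≡ 0
  Π¹-trashes-system t p =
    trans (Π¹-trashes t (inj₁ p)) (sum-tabulate-zero _ (λ N → Π¹-trashIf-system ⌊ destroys? t N ⌋ N p))

  Π¹-trashes-trash : ∀ t M → Π¹ cons (trashes t) (inj₂ M) ≡ FoCons t (inj₂ M)
  Π¹-trashes-trash t M = begin
    Π¹ cons (trashes t) (inj₂ M)                     ≡⟨ Π¹-trashes t (inj₂ M) ⟩
    sum (tabulate (λ N → Π¹ cons (trashFor t N) (inj₂ M)))
      ≡⟨ sum-tabulate-single _ M (λ N N≢M → Π¹-trashIf-other ⌊ destroys? t N ⌋ N≢M) ⟩
    Π¹ cons (trashFor t M) (inj₂ M)                  ≡⟨ Π¹-trashIf-self ⌊ destroys? t M ⌋ M ⟩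
    FoCons t (inj₂ M)                                ∎
    where open ≡-Reasoning

  Π²-trashes : ∀ t M x → Π² cons M (trashes t) x ≡ 0
  Π²-trashes t M x =
    trans (concat-tabulate-hom (λ xs → Π² cons M xs x) refl (λ xs ys → Cons.Π²-++ M xs ys x) (trashFor t))
          (sum-tabulate-zero _ (λ N → Π²-trashIf ⌊ destroys? t N ⌋ N M x))

  destroys⇒trash-produced : ∀ t N → Destroys t N → FoCons t (inj₂ N) ≢ 0
  destroys⇒trash-produced t N destroys with destroys? t N
  ... | yes _        = λ ()
  ... | no ¬destroys = ⊥-elim (¬destroys destroys)

  cons-conservative : Cons.Conservative
  cons-conservative t N (inj₂ _ , _ , Fi≢0) = ⊥-elim (Fi≢0 refl)
  cons-conservative t N (inj₁ p , dp≡N , Fi≢0) with any? (λ q → (d q ≟ N) ×-dec ¬? (Fo t q ℕ.≟ 0))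
  ... | yes (q , dq≡N , Fo≢0) = inj₁ q , dq≡N , Fo≢0
  ... | no ¬produced = inj₂ N , refl , destroys⇒trash-produced t N ((p , dp≡N , Fi≢0) , unproduced)
    where
      unproduced : ∀ q → d q ≡ N → Fo t q ≡ 0
      unproduced q dq≡N = decidable-stable (Fo t q ℕ.≟ 0) (λ Fo≢0 → ¬produced (q , dq≡N , Fo≢0))

  lift-Mode : ∀ {t θ lam ρ} → Raw.Mode t θ lam ρ → Cons.Mode t θ (lift lam) (lift ρ ++ trashes t)
  lift-Mode {t} {θ} {lam} {ρ} (Raw.mode consumes produces enabled effect) =
    Cons.mode consumes′ produces′ enabled′ effect′
    where
      consumes′ : ∀ q → Π¹ cons (lift lam) q ≡ FiCons q t
      consumes′ (inj₁ p) = trans (Π¹-lift-system lam p) (consumes p)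
      consumes′ (inj₂ N) = Π¹-lift-trash lam N

      produced : ∀ q → Π¹ cons (lift ρ) q + Π¹ cons (trashes t) q ≡ FoCons t q
      produced (inj₁ p) =
        trans (cong₂ _+_ (trans (Π¹-lift-system ρ p) (produces p)) (Π¹-trashes-system t p)) (+-identityʳ _)
      produced (inj₂ N) = cong₂ _+_ (Π¹-lift-trash ρ N) (Π¹-trashes-trash t N)

      produces′ : ∀ q → Π¹ cons (lift ρ ++ trashes t) q ≡ FoCons t q
      produces′ q = trans (Cons.Π¹-++ (lift ρ) (trashes t) q) (produced q)

      enabled′ : ∀ N x → preM (obj N) (θ N) x ≤ Π² cons N (lift lam) x
      enabled′ N x = subst (preM (obj N) (θ N) x ≤_) (sym (Π²-lift N lam x)) (enabled N x)

      effect′ : ∀ N x → Π² cons N (lift ρ ++ trashes t) x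
                        ≡ Π² cons N (lift lam) x ∸ preM (obj N) (θ N) x + postM (obj N) (θ N) x
      effect′ N x = begin
        Π² cons N (lift ρ ++ trashes t) x
          ≡⟨ Cons.Π²-++ N (lift ρ) (trashes t) x ⟩
        Π² cons N (lift ρ) x + Π² cons N (trashes t) x
          ≡⟨ cong₂ _+_ (Π²-lift N ρ x) (Π²-trashes t N x) ⟩
        Π² raw N ρ x + 0
          ≡⟨ trans (+-identityʳ _) (effect N x) ⟩
        Π² raw N lam x ∸ preM (obj N) (θ N) x + postM (obj N) (θ N) x
          ≡⟨ cong (λ z → z ∸ preM (obj N) (θ N) x + postM (obj N) (θ N) x) (sym (Π²-lift N lam x)) ⟩
        Π² cons N (lift lam) x ∸ preM (obj N) (θ N) x + postM (obj N) (θ N) x   ∎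
        where open ≡-Reasoning

  lift-Step : ∀ {C C′} → Step raw C C′ → ∃[ D ] (Step cons (lift C) D × lift C′ Cons.≼ D)
  lift-Step ((t , θ) , t,θ∈Θ , lam , ρ , rest , C↭ , consumes , produces , enabled , effect , refl) =
    lift rest ++ (lift ρ ++ trashes t) ,
    Cons.fire t,θ∈Θ (↭-trans (lift-↭ C↭) (↭-reflexive (lift-++ lam rest)))
                    (lift-Mode {lam = lam} {ρ} (Raw.mode consumes produces enabled effect)) ,
    subst (Cons._≼ lift rest ++ (lift ρ ++ trashes t)) (sym (lift-++ rest ρ))
          (Cons.≼-++⁺ Cons.≼-refl (Cons.≼-extend (lift ρ) (trashes t)))

  simulate-LossyOrStep : ∀ {C C′ D} → LossyOrStep raw C C′ → lift C Cons.≼ D →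
                         ∃[ D′ ] (Star (Step cons) D D′ × lift C′ Cons.≼ D′)
  simulate-LossyOrStep (inj₁ step) C≼D with lift-Step step
  ... | D₁ , step₁ , C′≼D₁ with Cons.conservative⇒monotone cons-conservative step₁ C≼D
  ...   | D′ , step′ , D₁≼D′ = D′ , step′ ◅ ε , Cons.≼-trans C′≼D₁ D₁≼D′
  simulate-LossyOrStep (inj₂ C′≤C) C≼D = _ , ε , Cons.≼-trans (lift-≼ C′≤C) C≼D

  simulate : ∀ {C C′ D} → Star (LossyOrStep raw) C C′ → lift C Cons.≼ D →
             ∃[ D′ ] (Star (Step cons) D D′ × lift C′ Cons.≼ D′)
  simulate ε C≼D = _ , ε , C≼D
  simulate (step ◅ run) C≼D with simulate-LossyOrStep step C≼D
  ... | D₁ , steps₁ , C₁≼D₁ with simulate run C₁≼D₁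
  ...   | D′ , steps , C′≼D′ = D′ , steps₁ ◅◅ steps , C′≼D′

  ωCoverable⇒Coverable : ∀ {ι τ} → ωCoverable raw ι τ → Coverable cons (lift ι) (lift τ)
  ωCoverable⇒Coverable (C , run , τ≤C) with simulate run Cons.≼-refl
  ... | D , steps , C≼D = D , steps , Cons.≼-trans (lift-≼ τ≤C) C≼D

theorem4 : (E : EOS) → EOS.StandingAssumptions E →
           (ι τ : Config (EOS.raw E)) →
           ωCoverable (EOS.raw E) ι τ →
           Coverable (EOS.cons E) (EOS.liftConfig E ι) (EOS.liftConfig E τ)
theorem4 E _ ι τ = ConservativeClosure.ωCoverable⇒Coverable E
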